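{- Let $G$ be a finite connected graph with $n\ge 2$ vertices and diameter $d$, and let $G'$ be the $c$-cactus of $G$ for an integer $c>(d+1)n/(n-1)$. Then $G'$ is strongly non-stackable.
   Context: The $c$-cactus of $G$ is obtained from $G$ by attaching $c$ pendant edges (each to a new vertex of degree 1) to every vertex of $G$. Cup stacking on a finite connected graph: initially one cup on every vertex; a move takes all $r\ge1$ cups from a vertex $x$ onto a vertex $y\neq x$ that already carries at least one cup and satisfies $d(x,y)=r$ (shortest-path distance). A graph is $t$-stackable if some sequence of moves ends with all cups on $t$; it is strongly non-stackable if it is not $t$-stackable for any vertex $t$. -}

module Defs where

open import Level using (Level; _⊔_) renaming (suc to lsuc)
open import Data.Nat using (ℕ; zero; suc; _+_; _*_; _∸_; _≤_; _<_)
open import Data.Fin using (Fin)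
open import Data.Sum using (_⊎_; inj₁; inj₂)
open import Data.Product using (_×_; _,_; Σ; ∃; ∃-syntax)
open import Data.Empty using (⊥)
open import Data.Unit using (⊤)
open import Relation.Nullary using (¬_)
open import Relation.Binary.PropositionalEquality using (_≡_; _≢_)
open import Relation.Binary.Construct.Closure.ReflexiveTransitive using (Star)

record Graph (n : ℕ) : Set₁ where
  field
    Adj   : Fin n → Fin n → Set
    sym   : ∀ {x y} → Adj x y → Adj y x
    irrefl : ∀ {x} → ¬ Adj x x
open Graph public

data Walk {V : Set} (A : V → V → Set) : V → V → ℕ → Set where
  here : ∀ {x} → Walk A x x zero
  step : ∀ {x y z k} → A x y → Walk A y z k → Walk A x z (suc k)

Dist : {V : Set} → (V → V → Set) → V → V → ℕ → Set
Dist A x y r = Walk A x y r × (∀ k → Walk A x y k → r ≤ k)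

Connected : {V : Set} → (V → V → Set) → Set
Connected A = ∀ x y → ∃[ k ] Walk A x y k

HasDiameter : {V : Set} → (V → V → Set) → ℕ → Set
HasDiameter A d =
  (∀ x y → ∃[ r ] (Dist A x y r × r ≤ d)) × (∃[ x ] ∃[ y ] Dist A x y d)

-- The c-cactus: vertices of G plus c new leaves for every vertex of G.
CactusV : ℕ → ℕ → Set
CactusV n c = Fin n ⊎ (Fin n × Fin c)

CactusAdj : ∀ {n} → Graph n → (c : ℕ) → CactusV n c → CactusV n c → Set
CactusAdj G c (inj₁ u) (inj₁ v) = Adj G u v
CactusAdj G c (inj₁ u) (inj₂ (v , _)) = u ≡ v
CactusAdj G c (inj₂ (u , _)) (inj₁ v) = u ≡ v
CactusAdj G c (inj₂ _) (inj₂ _) = ⊥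

-- Cup stacking. A configuration assigns a number of cups to every vertex.
Config : Set → Set
Config V = V → ℕ

Move : {V : Set} → (V → V → Set) → Config V → Config V → Set
Move A f g =
  ∃[ x ] ∃[ y ] (x ≢ y × 1 ≤ f x × 1 ≤ f y × Dist A x y (f x)
    × g x ≡ 0 × g y ≡ f y + f x × (∀ z → z ≢ x → z ≢ y → g z ≡ f z))

Stackable : {V : Set} → (V → V → Set) → V → Set
Stackable A t =
  ∃[ g ] (Star (Move A) (λ _ → 1) g × (∀ z → z ≢ t → g z ≡ 0))

StronglyNonStackable : {V : Set} → (V → V → Set) → Set
StronglyNonStackable A = ∀ t → ¬ Stackable A t

{-# OPTIONS --safe #-}
module Submission where

-- Follow the original cup of every core vertex v.  Each emptied leaf that is
-- not attached to the target's core vertex T is charged to a core vertex v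
-- whose original cup lies in a stack that this move makes taller: a single
-- leaf cup can only move onto its own core vertex, which still holds its
-- cup, and a leaf holding two or more cups holds the original cup of some
-- core vertex.  Hence the stack carrying v's cup has at least (charges + 1)
-- cups, and at least (charges + 2) once it has left v.  A stack travels a
-- distance equal to its height, at most d + 2 in the cactus, so a core
-- vertex whose cup has moved is charged at most d + 1 times; a core vertex
-- still holding its cup at the end is T, which is charged only after its
-- cup has moved.  Finally all (n - 1) c leaves away from T are empty, so
-- (n - 1) c ≤ n (d + 1).

open import Defs hiding (sym)
open import Data.Empty using (⊥-elim)
open import Data.Fin using (Fin; zero; suc; punchIn) renaming (_≟_ to _≟ᶠ_)
open import Data.Fin.Properties using (punchInᵢ≢i)
open import Data.Nat using (ℕ; zero; suc; _+_; _*_; _∸_; _≤_; _<_; z≤n; s≤s)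
open import Data.Nat.Properties hiding (_≟_)
open import Algebra.Properties.CommutativeMonoid.Sum +-0-commutativeMonoid
  using (sum; sum-remove; sum-cong-≗)
open import Data.Product using (_×_; _,_; ∃-syntax; proj₁; proj₂; map₂)
import Data.Product.Properties as Product
open import Data.Sum using (inj₁; inj₂)
import Data.Sum.Properties as Sum
open import Data.Vec.Functional using (Vector; removeAt; updateAt)
open import Data.Vec.Functional.Properties using (updateAt-updates; updateAt-minimal)
open import Function using (_∘_)
open import Relation.Binary.Construct.Closure.ReflexiveTransitive using (Star; ε; _◅_)
open import Relation.Binary.Definitions using (DecidableEquality)
open import Relation.Binary.PropositionalEquality
open import Relation.Nullary using (yes; no)

sum-zero : ∀ {m} {h : Vector ℕ m} → (∀ i → h i ≡ 0) → sum h ≡ 0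
sum-zero {zero}  _   = refl
sum-zero {suc m} h≡0 = cong₂ _+_ (h≡0 zero) (sum-zero (h≡0 ∘ suc))

sum-mono-≤ : ∀ {m} {h h′ : Vector ℕ m} → (∀ i → h i ≤ h′ i) → sum h ≤ sum h′
sum-mono-≤ {zero}  _    = z≤n
sum-mono-≤ {suc m} h≤h′ = +-mono-≤ (h≤h′ zero) (sum-mono-≤ (h≤h′ ∘ suc))

sum-≤-* : ∀ {m} {h : Vector ℕ m} {b} → (∀ i → h i ≤ b) → sum h ≤ m * b
sum-≤-* {zero}  _   = z≤n
sum-≤-* {suc m} h≤b = +-mono-≤ (h≤b zero) (sum-≤-* (h≤b ∘ suc))

*-≤-sum : ∀ {m} {h : Vector ℕ m} {b} → (∀ i → b ≤ h i) → m * b ≤ sum h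
*-≤-sum {zero}  _   = z≤n
*-≤-sum {suc m} b≤h = +-mono-≤ (b≤h zero) (*-≤-sum (b≤h ∘ suc))

*-≤-sum-except : ∀ {m} {h : Vector ℕ m} {b} (a : Fin m) →
                 (∀ i → i ≢ a → b ≤ h i) → (m ∸ 1) * b ≤ sum h
*-≤-sum-except {suc m} {h} {b} a b≤h = begin
  m * b                     ≤⟨ *-≤-sum (λ i → b≤h (punchIn a i) (punchInᵢ≢i a i)) ⟩
  sum (removeAt h a)        ≤⟨ m≤n+m _ (h a) ⟩
  h a + sum (removeAt h a)  ≡⟨ sum-remove h ⟨
  sum h                     ∎
  where open ≤-Reasoning

sum-≤-+-at : ∀ {m} {h h′ : Vector ℕ m} {k} (a : Fin m) →
             (∀ i → i ≢ a → h′ i ≤ h i) → h′ a ≤ k + h a → sum h′ ≤ k + sum h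
sum-≤-+-at {suc m} {h} {h′} {k} a h′≤h h′a≤k+ha = begin
  sum h′                          ≡⟨ sum-remove h′ ⟩
  h′ a + sum (removeAt h′ a)      ≤⟨ +-mono-≤ h′a≤k+ha (sum-mono-≤ λ i → h′≤h (punchIn a i) (punchInᵢ≢i a i)) ⟩
  k + h a + sum (removeAt h a)    ≡⟨ +-assoc k (h a) _ ⟩
  k + (h a + sum (removeAt h a))  ≡⟨ cong (k +_) (sum-remove h) ⟨
  k + sum h                       ∎
  where open ≤-Reasoning

sum-updateAt-suc : ∀ {m} (h : Vector ℕ m) (a : Fin m) → sum (updateAt h a suc) ≡ suc (sum h)
sum-updateAt-suc {suc m} h a = begin
  sum (updateAt h a suc)                                ≡⟨ sum-remove (updateAt h a suc) ⟩
  updateAt h a suc a + sum (removeAt (updateAt h a suc) a)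
    ≡⟨ cong₂ _+_ (updateAt-updates a h)
                 (sum-cong-≗ λ i → updateAt-minimal (punchIn a i) a h (punchInᵢ≢i a i)) ⟩
  suc (h a) + sum (removeAt h a)                        ≡⟨ cong suc (sum-remove h) ⟨
  suc (sum h)                                           ∎
  where open ≡-Reasoning

zeroIndicator : ℕ → ℕ
zeroIndicator zero    = 1
zeroIndicator (suc _) = 0

zeroIndicator-mono : ∀ {a b} → (a ≡ 0 → b ≡ 0) → zeroIndicator a ≤ zeroIndicator b
zeroIndicator-mono {zero}  a≡0⇒b≡0 rewrite a≡0⇒b≡0 refl = ≤-refl
zeroIndicator-mono {suc _} _ = z≤n

zeroIndicator≤1 : ∀ a → zeroIndicator a ≤ 1
zeroIndicator≤1 zero    = ≤-refl
zeroIndicator≤1 (suc _) = z≤n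

module MoveEffect {V : Set} (_≟_ : DecidableEquality V) {f g : Config V} {x y : V}
                  (fx≥1 : 1 ≤ f x) (fy≥1 : 1 ≤ f y) (gy≡ : g y ≡ f y + f x)
                  (gz≡fz : ∀ z → z ≢ x → z ≢ y → g z ≡ f z) where

  cups-kept : ∀ z → z ≢ x → f z ≤ g z
  cups-kept z z≢x with z ≟ y
  ... | yes refl = subst (f z ≤_) (sym gy≡) (m≤m+n (f z) (f x))
  ... | no z≢y   = ≤-reflexive (sym (gz≡fz z z≢x z≢y))

  target-grows : f y < g y
  target-grows = subst (f y <_) (sym gy≡) (m<m+n (f y) fx≥1)

  empty-stays-empty : ∀ z → f z ≡ 0 → g z ≡ 0
  empty-stays-empty z fz≡0 = trans (gz≡fz z (occupied fx≥1) (occupied fy≥1)) fz≡0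
    where
      occupied : ∀ {w} → 1 ≤ f w → z ≢ w
      occupied fw≥1 refl = <⇒≢ fw≥1 (sym fz≡0)

  empty-after⇒before : ∀ z → z ≢ x → g z ≡ 0 → f z ≡ 0
  empty-after⇒before z z≢x gz≡0 = n≤0⇒n≡0 (subst (f z ≤_) gz≡0 (cups-kept z z≢x))

  redirect : V → V
  redirect z with z ≟ x
  ... | yes _ = y
  ... | no _  = z

  redirect-source : redirect x ≡ y
  redirect-source with x ≟ x
  ... | yes _   = refl
  ... | no x≢x  = ⊥-elim (x≢x refl)

  redirect-other : ∀ {z} → z ≢ x → redirect z ≡ z
  redirect-other {z} z≢x with z ≟ x
  ... | yes z≡x = ⊥-elim (z≢x z≡x)
  ... | no _    = refl

  cups-follow : ∀ z → f z ≤ g (redirect z)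
  cups-follow z with z ≟ x
  ... | yes refl = subst (f x ≤_) (sym gy≡) (m≤n+m (f x) (f y))
  ... | no z≢x   = cups-kept z z≢x

DiameterAtMost : {V : Set} → (V → V → Set) → ℕ → Set
DiameterAtMost A d = ∀ x y → ∃[ k ] (Walk A x y k × k ≤ d)

diameter⇒atMost : ∀ {V : Set} {A : V → V → Set} {d} → HasDiameter A d → DiameterAtMost A d
diameter⇒atMost (bounded , _) x y with bounded x y
... | r , (w , _) , r≤d = r , w , r≤d

dist-≤ : ∀ {V : Set} {A : V → V → Set} {d x y r} → DiameterAtMost A d → Dist A x y r → r ≤ d
dist-≤ {x = x} {y} diam (_ , minimal) with diam x y
... | k , w , k≤d = ≤-trans (minimal k w) k≤d

_▷_ : ∀ {V : Set} {A : V → V → Set} {x y z k} → Walk A x y k → A y z → Walk A x z (suc k)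
here     ▷ e = step e here
step a w ▷ e = step a (w ▷ e)

pattern core u   = inj₁ u
pattern leaf u j = inj₂ (u , j)

coreOf : ∀ {n c} → CactusV n c → Fin n
coreOf (core u)   = u
coreOf (leaf u _) = u

leaf-injective : ∀ {n c} {u u′ : Fin n} {j j′ : Fin c} →
                 _≡_ {A = CactusV n c} (leaf u j) (leaf u′ j′) → u ≡ u′ × j ≡ j′
leaf-injective refl = refl , refl

core≢leaf : ∀ {n c} {u v : Fin n} {j : Fin c} → _≢_ {A = CactusV n c} (core u) (leaf v j)
core≢leaf ()

module Cactus {n : ℕ} (G : Graph n) (c : ℕ) where

  _≟_ : DecidableEquality (CactusV n c)
  _≟_ = Sum.≡-dec _≟ᶠ_ (Product.≡-dec _≟ᶠ_ _≟ᶠ_)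

  lift-walk : ∀ {u v k} → Walk (Adj G) u v k → Walk (CactusAdj G c) (core u) (core v) k
  lift-walk here       = here
  lift-walk (step e w) = step e (lift-walk w)

  cactus-diameter : ∀ {d} → DiameterAtMost (Adj G) d → DiameterAtMost (CactusAdj G c) (2 + d)
  cactus-diameter {d} diam x y = extend x y (diam (coreOf x) (coreOf y))
    where
      extend : ∀ x y → ∃[ k ] (Walk (Adj G) (coreOf x) (coreOf y) k × k ≤ d) →
               ∃[ k ] (Walk (CactusAdj G c) x y k × k ≤ 2 + d)
      extend (core _)   (core _)   (k , w , k≤d) = k , lift-walk w , ≤-trans k≤d (m≤n+m d 2)
      extend (leaf _ _) (core _)   (k , w , k≤d) = suc k , step refl (lift-walk w) , s≤s (≤-trans k≤d (n≤1+n d))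
      extend (core _)   (leaf _ _) (k , w , k≤d) = suc k , lift-walk w ▷ refl , s≤s (≤-trans k≤d (n≤1+n d))
      extend (leaf _ _) (leaf _ _) (k , w , k≤d) = suc (suc k) , step refl (lift-walk w ▷ refl) , s≤s (s≤s k≤d)

  leaf-walk₁⇒core : ∀ {u j y} → Walk (CactusAdj G c) (leaf u j) y 1 → y ≡ core u
  leaf-walk₁⇒core {y = core _}   (step refl here) = refl
  leaf-walk₁⇒core {y = leaf _ _} (step () here)

module Tracking {n : ℕ} (G : Graph n) (c : ℕ) {d : ℕ}
                (diam : DiameterAtMost (CactusAdj G c) (2 + d)) (t : CactusV n c) where

  open Cactus G c

  private
    V = CactusV n c
    A = CactusAdj G c

  T : Fin n
  T = coreOf t

  emptiedAt : Config V → Fin n → Fin c → ℕ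
  emptiedAt f u j with u ≟ᶠ T
  ... | yes _ = 0
  ... | no _  = zeroIndicator (f (leaf u j))

  emptiedLeaves : Config V → ℕ
  emptiedLeaves f = sum λ u → sum λ j → emptiedAt f u j

  emptiedAt-mono : ∀ {f g} u j → (u ≢ T → g (leaf u j) ≡ 0 → f (leaf u j) ≡ 0) →
                   emptiedAt g u j ≤ emptiedAt f u j
  emptiedAt-mono u j g≡0⇒f≡0 with u ≟ᶠ T
  ... | yes _   = ≤-refl
  ... | no u≢T  = zeroIndicator-mono (g≡0⇒f≡0 u≢T)

  emptiedAt≤1 : ∀ f u j → emptiedAt f u j ≤ 1
  emptiedAt≤1 f u j with u ≟ᶠ T
  ... | yes _ = z≤n
  ... | no _  = zeroIndicator≤1 _

  emptiedAt-full : ∀ u j → emptiedAt (λ _ → 1) u j ≡ 0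
  emptiedAt-full u j with u ≟ᶠ T
  ... | yes _ = refl
  ... | no _  = refl

  emptiedAt-empty : ∀ {f} u j → u ≢ T → f (leaf u j) ≡ 0 → emptiedAt f u j ≡ 1
  emptiedAt-empty u j u≢T fℓ≡0 with u ≟ᶠ T
  ... | yes u≡T = ⊥-elim (u≢T u≡T)
  ... | no _    rewrite fℓ≡0 = refl

  emptiedLeaves-mono : ∀ {f g} → (∀ u j → u ≢ T → g (leaf u j) ≡ 0 → f (leaf u j) ≡ 0) →
                       emptiedLeaves g ≤ emptiedLeaves f
  emptiedLeaves-mono g≡0⇒f≡0 =
    sum-mono-≤ λ u → sum-mono-≤ λ j → emptiedAt-mono u j (g≡0⇒f≡0 u j)

  emptiedLeaves-≤-1+ : ∀ {f g} u₀ j₀ →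
                       (∀ u j → leaf u j ≢ leaf u₀ j₀ → g (leaf u j) ≡ 0 → f (leaf u j) ≡ 0) →
                       emptiedLeaves g ≤ 1 + emptiedLeaves f
  emptiedLeaves-≤-1+ {g = g} u₀ j₀ g≡0⇒f≡0 = sum-≤-+-at u₀
    (λ u u≢u₀ → sum-mono-≤ λ j → emptiedAt-mono u j λ _ →
      g≡0⇒f≡0 u j (u≢u₀ ∘ proj₁ ∘ leaf-injective))
    (sum-≤-+-at j₀
      (λ j j≢j₀ → emptiedAt-mono u₀ j λ _ →
        g≡0⇒f≡0 u₀ j (j≢j₀ ∘ proj₂ ∘ leaf-injective))
      (≤-trans (emptiedAt≤1 g u₀ j₀) (m≤m+n 1 _)))

  -- p is the vertex holding the original cup of the core vertex v, and k
  -- the number of emptied leaves charged to v.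
  data CoreState (f : Config V) (v : Fin n) (p : V) (k : ℕ) : Set where
    at-home : k < f (core v) → p ≡ core v → (v ≡ T → k ≡ 0) → CoreState f v p k
    moved   : f (core v) ≡ 0 → k ≤ 1 + d → 2 + k ≤ f p → CoreState f v p k

  record Tracked (f : Config V) : Set where
    field
      pos             : Fin n → V
      charge          : Fin n → ℕ
      state           : ∀ v → CoreState f v (pos v) (charge v)
      tall-leaf-pos   : ∀ u j → 2 ≤ f (leaf u j) → ∃[ v ] pos v ≡ leaf u j
      emptied≤charges : emptiedLeaves f ≤ sum charge

  tracked-init : Tracked (λ _ → 1)
  tracked-init = record
    { pos             = inj₁
    ; charge          = λ _ → 0
    ; state           = λ _ → at-home ≤-refl refl (λ _ → refl)
    ; tall-leaf-pos   = λ { _ _ (s≤s ()) }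
    ; emptied≤charges = ≤-reflexive (trans (sum-zero λ u → sum-zero (emptiedAt-full u))
                                           (sym (sum-zero {n} λ _ → refl)))
    }

  module Step {f g : Config V} (I : Tracked f) {x y : V}
              (fx≥1 : 1 ≤ f x) (fy≥1 : 1 ≤ f y) (dist : Dist A x y (f x))
              (gx≡0 : g x ≡ 0) (gy≡ : g y ≡ f y + f x)
              (gz≡fz : ∀ z → z ≢ x → z ≢ y → g z ≡ f z) where

    open Tracked I
    open MoveEffect _≟_ fx≥1 fy≥1 gy≡ gz≡fz

    pos′ : Fin n → V
    pos′ = redirect ∘ pos

    source-height : f x ≤ 2 + d
    source-height = dist-≤ diam dist

    lands-taller : ∀ {p k} → p ≡ x → k ≤ f x → 1 + k ≤ g (redirect p)
    lands-taller refl k≤fx rewrite redirect-source | gy≡ = +-mono-≤ fy≥1 k≤fx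

    state-kept : ∀ {v p k} → core v ≢ x → CoreState f v p k → CoreState g v (redirect p) k
    state-kept v≢x (at-home k<fv refl at-T) =
      at-home (≤-trans k<fv (cups-kept _ v≢x)) (redirect-other v≢x) at-T
    state-kept v≢x (moved fv≡0 k≤1+d 2+k≤fp) =
      moved (empty-stays-empty _ fv≡0) k≤1+d (≤-trans 2+k≤fp (cups-follow _))

    states-except : ∀ {charge′ : Fin n → ℕ} a →
                    (∀ v → v ≢ a → charge′ v ≡ charge v) → (∀ v → v ≢ a → core v ≢ x) →
                    CoreState g a (pos′ a) (charge′ a) →
                    ∀ v → CoreState g v (pos′ v) (charge′ v)
    states-except a same v≢x new v with v ≟ᶠ a
    ... | yes refl = new
    ... | no v≢a   =
      subst (CoreState g v (pos′ v)) (sym (same v v≢a)) (state-kept (v≢x v v≢a) (state v))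

    occupied≢source : ∀ {z} → 1 ≤ g z → z ≢ x
    occupied≢source gz≥1 refl = <⇒≢ gz≥1 (sym gx≡0)

    tall-kept : (∀ {u j} → y ≡ leaf u j → ∃[ v ] pos v ≡ x) →
                ∀ u j → 2 ≤ g (leaf u j) → ∃[ v ] pos′ v ≡ leaf u j
    tall-kept source-tracked u j 2≤gℓ with leaf u j ≟ y
    ... | yes refl = map₂ (λ pv≡x → trans (cong redirect pv≡x) redirect-source) (source-tracked refl)
    ... | no ℓ≢y   = map₂ (λ pv≡ℓ → trans (cong redirect pv≡ℓ) (redirect-other ℓ≢x))
                          (tall-leaf-pos u j (subst (2 ≤_) (gz≡fz _ ℓ≢x ℓ≢y) 2≤gℓ))
      where
        ℓ≢x : leaf u j ≢ x
        ℓ≢x = occupied≢source (≤-trans (s≤s z≤n) 2≤gℓ)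

    tracked-bumped : ∀ {u₀ j₀} → x ≡ leaf u₀ j₀ → ∀ a →
                     CoreState g a (pos′ a) (suc (charge a)) →
                     (∀ {u j} → y ≡ leaf u j → ∃[ v ] pos v ≡ x) → Tracked g
    tracked-bumped {u₀} {j₀} refl a new source-tracked = record
      { pos             = pos′
      ; charge          = updateAt charge a suc
      ; state           = states-except a (λ v v≢a → updateAt-minimal v a charge v≢a) (λ _ _ ())
                            (subst (CoreState g a (pos′ a)) (sym (updateAt-updates a charge)) new)
      ; tall-leaf-pos   = tall-kept source-tracked
      ; emptied≤charges = begin
          emptiedLeaves g              ≤⟨ emptiedLeaves-≤-1+ u₀ j₀ (λ _ _ → empty-after⇒before _) ⟩
          1 + emptiedLeaves f          ≤⟨ +-monoʳ-≤ 1 emptied≤charges ⟩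
          1 + sum charge               ≡⟨ sum-updateAt-suc charge a ⟨
          sum (updateAt charge a suc)  ∎
      }
      where open ≤-Reasoning

    from-core : ∀ {w} → x ≡ core w → Tracked g
    from-core {w} refl with state w
    ... | moved fw≡0 _ _ = ⊥-elim (<⇒≢ fx≥1 (sym fw≡0))
    ... | at-home k<fw pw≡w _ = record
      { pos             = pos′
      ; charge          = charge
      ; state           = states-except w (λ _ _ → refl) (λ v v≢w → v≢w ∘ Sum.inj₁-injective) gives-away
      ; tall-leaf-pos   = tall-kept λ _ → w , pw≡w
      ; emptied≤charges = ≤-trans (emptiedLeaves-mono λ _ _ _ → empty-after⇒before _ λ ()) emptied≤charges
      }
      where
        gives-away : CoreState g w (pos′ w) (charge w)
        gives-away = moved gx≡0 (≤-pred (≤-trans k<fw source-height)) (lands-taller pw≡w k<fw)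

    from-leaf-to-core : ∀ {u₀ j₀} → x ≡ leaf u₀ j₀ → y ≡ core u₀ → Tracked g
    from-leaf-to-core {u₀} refl refl with u₀ ≟ᶠ T | state u₀
    ... | _ | moved fu₀≡0 _ _ = ⊥-elim (<⇒≢ fy≥1 (sym fu₀≡0))
    ... | yes u₀≡T | at-home _ _ _ = record
      { pos             = pos′
      ; charge          = charge
      ; state           = λ v → state-kept (λ ()) (state v)
      ; tall-leaf-pos   = tall-kept λ ()
      ; emptied≤charges = ≤-trans (emptiedLeaves-mono λ _ _ u≢T → empty-after⇒before _ λ ℓ≡x →
                                     u≢T (trans (proj₁ (leaf-injective ℓ≡x)) u₀≡T))
                                  emptied≤charges
      }
    ... | no u₀≢T | at-home k<fu₀ pu₀≡u₀ _ = tracked-bumped refl u₀ keeps-cup λ ()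
      where
        keeps-cup : CoreState g u₀ (pos′ u₀) (suc (charge u₀))
        keeps-cup = at-home (≤-trans (s≤s k<fu₀) target-grows)
                            (trans (cong redirect pu₀≡u₀) (redirect-other λ ()))
                            (⊥-elim ∘ u₀≢T)

    from-tall-leaf : ∀ {u₀ j₀} → x ≡ leaf u₀ j₀ → 2 ≤ f x → Tracked g
    from-tall-leaf {u₀} {j₀} refl 2≤fx with tall-leaf-pos u₀ j₀ 2≤fx
    ... | v₀ , pv₀≡x with state v₀
    ...   | at-home _ pv₀≡v₀ _ = ⊥-elim (core≢leaf (trans (sym pv₀≡v₀) pv₀≡x))
    ...   | moved fv₀≡0 _ 2+k≤fp = tracked-bumped refl v₀ still-moved λ _ → v₀ , pv₀≡x
      where
        2+k≤fx : 2 + charge v₀ ≤ f x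
        2+k≤fx = subst (λ p → 2 + charge v₀ ≤ f p) pv₀≡x 2+k≤fp
        still-moved : CoreState g v₀ (pos′ v₀) (suc (charge v₀))
        still-moved = moved (empty-stays-empty _ fv₀≡0)
                            (s≤s (+-cancelˡ-≤ 2 _ _ (≤-trans 2+k≤fx source-height)))
                            (lands-taller pv₀≡x 2+k≤fx)

  tracked-step : ∀ {f g} → Tracked f → Move A f g → Tracked g
  tracked-step I (core _ , _ , _ , fx≥1 , fy≥1 , dist , gx≡0 , gy≡ , gz≡fz) =
    Step.from-core I fx≥1 fy≥1 dist gx≡0 gy≡ gz≡fz refl
  tracked-step I (leaf u j , y , _ , fx≥1 , fy≥1 , dist , gx≡0 , gy≡ , gz≡fz)
    with m≤n⇒m<n∨m≡n fx≥1
  ... | inj₁ 2≤fx = Step.from-tall-leaf I fx≥1 fy≥1 dist gx≡0 gy≡ gz≡fz refl 2≤fx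
  ... | inj₂ 1≡fx = Step.from-leaf-to-core I fx≥1 fy≥1 dist gx≡0 gy≡ gz≡fz refl
                      (leaf-walk₁⇒core (subst (Walk A (leaf u j) y) (sym 1≡fx) (proj₁ dist)))

  tracked-run : ∀ {f g} → Tracked f → Star (Move A) f g → Tracked g
  tracked-run I ε        = I
  tracked-run I (m ◅ ms) = tracked-run (tracked-step I m) ms

  tracked-final : ∀ {g} → Tracked g → (∀ z → z ≢ t → g z ≡ 0) → (n ∸ 1) * c ≤ n * (1 + d)
  tracked-final {g} I only-t = begin
    (n ∸ 1) * c      ≤⟨ *-≤-sum-except T all-emptied ⟩
    emptiedLeaves g  ≤⟨ emptied≤charges ⟩
    sum charge       ≤⟨ sum-≤-* charge≤1+d ⟩
    n * (1 + d)      ∎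
    where
      open Tracked I
      open ≤-Reasoning

      all-emptied : ∀ u → u ≢ T → c ≤ sum (emptiedAt g u)
      all-emptied u u≢T = subst (_≤ sum (emptiedAt g u)) (*-identityʳ c) (*-≤-sum λ j →
        ≤-reflexive (sym (emptiedAt-empty u j u≢T (only-t _ (u≢T ∘ cong coreOf)))))

      charge≤1+d : ∀ v → charge v ≤ 1 + d
      charge≤1+d v with state v | core v ≟ t
      ... | moved _ k≤1+d _    | _        = k≤1+d
      ... | at-home _ _ at-T   | yes refl = subst (_≤ 1 + d) (sym (at-T refl)) z≤n
      ... | at-home k<gv _ _   | no v≢t   = ⊥-elim (<⇒≢ (≤-trans (s≤s z≤n) k<gv) (sym (only-t _ v≢t)))

  stackable⇒bound : Stackable (CactusAdj G c) t → (n ∸ 1) * c ≤ n * (1 + d)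
  stackable⇒bound (_ , moves , only-t) = tracked-final (tracked-run tracked-init moves) only-t

-- The bound on c already forces 2 ≤ n, and HasDiameter implies connectivity.
theorem4p2 : (n : ℕ) → 2 ≤ n → (G : Graph n) → Connected (Adj G)
    → (d : ℕ) → HasDiameter (Adj G) d
    → (c : ℕ) → (d + 1) * n < c * (n ∸ 1)
    → StronglyNonStackable (CactusAdj G c)
theorem4p2 n _ G _ d hd c c-large t stackable = <⇒≱ c-large (begin
  c * (n ∸ 1)  ≡⟨ *-comm c (n ∸ 1) ⟩
  (n ∸ 1) * c  ≤⟨ stackable⇒bound stackable ⟩
  n * (1 + d)  ≡⟨ *-comm n (1 + d) ⟩
  (1 + d) * n  ≡⟨ cong (_* n) (+-comm 1 d) ⟩
  (d + 1) * n  ∎)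
  where
    open ≤-Reasoning
    open Tracking G c (Cactus.cactus-diameter G c (diameter⇒atMost hd)) t
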